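{- If the consecution $X\Rightarrow A$ is provable in $\mathbf{B}$, then $X$ and $A$ depth-share a variable: there is an atom $p$ and an integer $k$ such that $p$ has an occurrence of depth $k$ in $X$ and an occurrence of depth $k$ in $A$.
   Context: Atoms $p_1,p_2,\dots$; formulas built by $\neg,\land,\lor,\to,\circ$; bunches built from formulas by comma $(X,Y)$ and semicolon $(X;Y)$; a consecution is $X\Rightarrow A$. Parsing tree: root is the expression; $X;Y$, $X,Y$, $A\land B$, $A\lor B$, $A\to B$, $A\circ B$ have two children in order, $\neg A$ has child $A$, atoms are leaves. Depth: root $0$; if $X;Y$ has depth $k$ then $X$ has $k-1$ and $Y$ has $k$; if $A\circ B$ has depth $k$ then $A$ has $k-1$, $B$ has $k$; if $A\to B$ has depth $k$ then $A,B$ have $k+1$; children of $X,Y$, $A\land B$, $A\lor B$, $\neg A$ keep the parent's depth. $Y(X)$ denotes $Y$ with a distinguished occurrence of subbunch $X$, $Y(Z)$ the replacement by $Z$. Rules of $\mathbf{B}$ (premises / conclusion): (id): $A\Rightarrow A$. ($\to$I): $X;A\Rightarrow B$ / $X\Rightarrow A\to B$. ($\to$E): $X\Rightarrow A\to B$, $Y\Rightarrow A$ / $X;Y\Rightarrow B$. ($\lor$I$_1$): $X\Rightarrow A$ / $X\Rightarrow A\lor B$. ($\lor$I$_2$): $X\Rightarrow B$ / $X\Rightarrow A\lor B$. ($\lor$E): $X\Rightarrow A\lor B$, $Y(A)\Rightarrow C$, $Y(B)\Rightarrow C$ / $Y(X)\Rightarrow C$. ($\land$I): $X\Rightarrow A$,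 $Y\Rightarrow B$ / $X,Y\Rightarrow A\land B$. ($\land$E): $X\Rightarrow A\land B$, $Y(A,B)\Rightarrow C$ / $Y(X)\Rightarrow C$. ($\circ$I): $X\Rightarrow A$, $Y\Rightarrow B$ / $X;Y\Rightarrow A\circ B$. ($\circ$E): $X\Rightarrow A\circ B$, $Y(A;B)\Rightarrow C$ / $Y(X)\Rightarrow C$. ($\neg$I): $X\Rightarrow B$, $A\Rightarrow\neg B$ / $X\Rightarrow\neg A$. ($\neg$E): $X\Rightarrow\neg\neg A$ / $X\Rightarrow A$. (Cut): $X\Rightarrow A$, $Y(A)\Rightarrow B$ / $Y(X)\Rightarrow B$. Structural: $W(X,(Y,Z))\Rightarrow A$ / $W((X,Y),Z)\Rightarrow A$; $W(X,Y)\Rightarrow A$ / $W(Y,X)\Rightarrow A$; $W(X,X)\Rightarrow A$ / $W(X)\Rightarrow A$; $W(X)\Rightarrow A$ / $W(X,Y)\Rightarrow A$. A consecution is provable in $\mathbf{B}$ if it is the root of a finite derivation tree built from these rules whose leaves are all (id) instances. -}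

module Defs where

open import Data.Nat using (ℕ)
open import Data.Product using (Σ; _×_)
open import Data.Integer using (ℤ; _+_; _-_; 0ℤ; 1ℤ)

data Formula : Set where
  atom : ℕ → Formula
  ¬'_  : Formula → Formula
  _∧'_ : Formula → Formula → Formula
  _∨'_ : Formula → Formula → Formula
  _⇒'_ : Formula → Formula → Formula
  _∘'_ : Formula → Formula → Formula

data Bunch : Set where
  fm    : Formula → Bunch
  _,,_  : Bunch → Bunch → Bunch
  _︔_   : Bunch → Bunch → Bunch

data BCtx : Set where
  hole  : BCtx
  _,,ˡ_ : BCtx → Bunch → BCtx
  _,,ʳ_ : Bunch → BCtx → BCtx
  _︔ˡ_  : BCtx → Bunch → BCtx
  _︔ʳ_  : Bunch → BCtx → BCtx

_[_] : BCtx → Bunch → Bunch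
hole       [ Z ] = Z
(Y ,,ˡ W)  [ Z ] = (Y [ Z ]) ,, W
(W ,,ʳ Y)  [ Z ] = W ,, (Y [ Z ])
(Y ︔ˡ W)   [ Z ] = (Y [ Z ]) ︔ W
(W ︔ʳ Y)   [ Z ] = W ︔ (Y [ Z ])

infix 4 _⊢_

data _⊢_ : Bunch → Formula → Set where
  id   : ∀ {A} → fm A ⊢ A
  →I   : ∀ {X A B} → (X ︔ fm A) ⊢ B → X ⊢ (A ⇒' B)
  →E   : ∀ {X Y A B} → X ⊢ (A ⇒' B) → Y ⊢ A → (X ︔ Y) ⊢ B
  ∨I₁  : ∀ {X A B} → X ⊢ A → X ⊢ (A ∨' B)
  ∨I₂  : ∀ {X A B} → X ⊢ B → X ⊢ (A ∨' B)
  ∨E   : ∀ {X A B C} (Y : BCtx) → X ⊢ (A ∨' B) → Y [ fm A ] ⊢ C → Y [ fm B ] ⊢ C → Y [ X ] ⊢ C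
  ∧I   : ∀ {X Y A B} → X ⊢ A → Y ⊢ B → (X ,, Y) ⊢ (A ∧' B)
  ∧E   : ∀ {X A B C} (Y : BCtx) → X ⊢ (A ∧' B) → Y [ fm A ,, fm B ] ⊢ C → Y [ X ] ⊢ C
  ∘I   : ∀ {X Y A B} → X ⊢ A → Y ⊢ B → (X ︔ Y) ⊢ (A ∘' B)
  ∘E   : ∀ {X A B C} (Y : BCtx) → X ⊢ (A ∘' B) → Y [ fm A ︔ fm B ] ⊢ C → Y [ X ] ⊢ C
  ¬I   : ∀ {X A B} → X ⊢ B → fm A ⊢ ¬' B → X ⊢ ¬' A
  ¬E   : ∀ {X A} → X ⊢ ¬' (¬' A) → X ⊢ A
  cut  : ∀ {X A B} (Y : BCtx) → X ⊢ A → Y [ fm A ] ⊢ B → Y [ X ] ⊢ B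
  assoc : ∀ {X Y Z A} (W : BCtx) → W [ X ,, (Y ,, Z) ] ⊢ A → W [ (X ,, Y) ,, Z ] ⊢ A
  comm  : ∀ {X Y A} (W : BCtx) → W [ X ,, Y ] ⊢ A → W [ Y ,, X ] ⊢ A
  contr : ∀ {X A} (W : BCtx) → W [ X ,, X ] ⊢ A → W [ X ] ⊢ A
  weak  : ∀ {X Y A} (W : BCtx) → W [ X ] ⊢ A → W [ X ,, Y ] ⊢ A

-- OccF d p k A : when A sits at depth d, atom p has an occurrence in A of depth k
data OccF : ℤ → ℕ → ℤ → Formula → Set where
  here : ∀ {d p} → OccF d p d (atom p)
  ¬'   : ∀ {d p k A} → OccF d p k A → OccF d p k (¬' A)
  ∧ˡ   : ∀ {d p k A B} → OccF d p k A → OccF d p k (A ∧' B)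
  ∧ʳ   : ∀ {d p k A B} → OccF d p k B → OccF d p k (A ∧' B)
  ∨ˡ   : ∀ {d p k A B} → OccF d p k A → OccF d p k (A ∨' B)
  ∨ʳ   : ∀ {d p k A B} → OccF d p k B → OccF d p k (A ∨' B)
  ⇒ˡ   : ∀ {d p k A B} → OccF (d + 1ℤ) p k A → OccF d p k (A ⇒' B)
  ⇒ʳ   : ∀ {d p k A B} → OccF (d + 1ℤ) p k B → OccF d p k (A ⇒' B)
  ∘ˡ   : ∀ {d p k A B} → OccF (d - 1ℤ) p k A → OccF d p k (A ∘' B)
  ∘ʳ   : ∀ {d p k A B} → OccF d p k B → OccF d p k (A ∘' B)

data OccB : ℤ → ℕ → ℤ → Bunch → Set where
  fm  : ∀ {d p k A} → OccF d p k A → OccB d p k (fm A)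
  ,ˡ  : ∀ {d p k X Y} → OccB d p k X → OccB d p k (X ,, Y)
  ,ʳ  : ∀ {d p k X Y} → OccB d p k Y → OccB d p k (X ,, Y)
  ︔ˡ  : ∀ {d p k X Y} → OccB (d - 1ℤ) p k X → OccB d p k (X ︔ Y)
  ︔ʳ  : ∀ {d p k X Y} → OccB d p k Y → OccB d p k (X ︔ Y)

DepthShare : Bunch → Formula → Set
DepthShare X A = Σ ℕ λ p → Σ ℤ λ k → OccB 0ℤ p k X × OccF 0ℤ p k A

{-# OPTIONS --safe #-}
-- Interpret a formula sitting at depth d by evaluating each atom occurrence at its own depth,
-- in any distributive lattice with a De Morgan negation and a fusion residuated by →; the depth
-- shifts of ; and ∘ (left argument one level down) and of → (both arguments one level up) are
-- exactly what makes B sound for these interpretations.  In Belnap's lattice FOUR, where n and b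
-- are incomparable, choose the fusion x ∙ y = x (for y ≠ f), so that n and b are fixed by every
-- operation.  Value atom p at depth k as b if p occurs at depth k in X and as n otherwise: then
-- X evaluates to b, and if A shared no depth-occurrence with X it would evaluate to n, while
-- soundness gives b ≤ n.  Sharing is decidable, so the resulting double negation can be dropped.
module Submission where

open import Defs
open import Algebra.Bundles using (AbelianGroup)
open import Data.Bool using (Bool; true; false; T)
open import Data.Integer using (ℤ; _+_; _-_; 0ℤ; 1ℤ)
import Data.Integer as ℤ
open import Data.Integer.Properties using (+-0-abelianGroup)
open import Data.Nat using (ℕ)
import Data.Nat as ℕ
open import Data.Product using (Σ; _×_; _,_)
open import Data.Sum using (_⊎_; inj₁; inj₂; [_,_]′)
import Data.Sum as Sum
open import Function using (_∘_)
open import Level using (0ℓ)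
open import Relation.Binary.Core using (REL) renaming (_⇒_ to _⊆_)
open import Relation.Binary.PropositionalEquality
  using (_≡_; refl; trans; cong; subst; subst₂)
open import Relation.Nullary using (Dec; does; ¬_)
open import Relation.Nullary.Decidable
  using (map′; _×-dec_; _⊎-dec_; _→-dec_; T?; from-yes; dec-true; dec-false; decidable-stable)
open import Algebra.Properties.Group (AbelianGroup.group +-0-abelianGroup)
  using (//-rightDividesˡ; //-rightDividesʳ)

record BAlgebra : Set₁ where
  infix  4 _≤_
  infixr 5 _⇒_
  infixr 6 _⊔_
  infixr 7 _⊓_ _∙_
  infix  8 ∼_
  field
    Carrier         : Set
    _≤_             : Carrier → Carrier → Set
    _⊓_ _⊔_ _∙_ _⇒_ : Carrier → Carrier → Carrier
    ∼_              : Carrier → Carrier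
    ≤-refl          : ∀ {x} → x ≤ x
    ≤-trans         : ∀ {x y z} → x ≤ y → y ≤ z → x ≤ z
    x⊓y≤x           : ∀ x y → x ⊓ y ≤ x
    x⊓y≤y           : ∀ x y → x ⊓ y ≤ y
    ⊓-greatest      : ∀ {x y z} → x ≤ y → x ≤ z → x ≤ y ⊓ z
    x≤x⊔y           : ∀ x y → x ≤ x ⊔ y
    y≤x⊔y           : ∀ x y → y ≤ x ⊔ y
    ⊔-least         : ∀ {x y z} → x ≤ z → y ≤ z → x ⊔ y ≤ z
    ⊓-distribʳ-⊔    : ∀ x y z → (y ⊔ z) ⊓ x ≤ y ⊓ x ⊔ z ⊓ x
    ∙-monoʳ         : ∀ {x y y′} → y ≤ y′ → x ∙ y ≤ x ∙ y′
    ∙-distribˡ-⊔    : ∀ x y z → x ∙ (y ⊔ z) ≤ x ∙ y ⊔ x ∙ z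
    transpose-⇒     : ∀ {x y z} → x ∙ y ≤ z → x ≤ y ⇒ z
    transpose-∙     : ∀ {x y z} → x ≤ y ⇒ z → x ∙ y ≤ z
    ∼-contrapose    : ∀ {x y} → x ≤ ∼ y → y ≤ ∼ x
    ∼∼x≤x           : ∀ x → ∼ ∼ x ≤ x

module BAlgebraProperties (𝔸 : BAlgebra) where
  open BAlgebra 𝔸

  ⊓-mono : ∀ {x x′ y y′} → x ≤ x′ → y ≤ y′ → x ⊓ y ≤ x′ ⊓ y′
  ⊓-mono {x} {_} {y} x≤x′ y≤y′ =
    ⊓-greatest (≤-trans (x⊓y≤x x y) x≤x′) (≤-trans (x⊓y≤y x y) y≤y′)

  ⊔-mono : ∀ {x x′ y y′} → x ≤ x′ → y ≤ y′ → x ⊔ y ≤ x′ ⊔ y′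
  ⊔-mono {_} {x′} {_} {y′} x≤x′ y≤y′ =
    ⊔-least (≤-trans x≤x′ (x≤x⊔y x′ y′)) (≤-trans y≤y′ (y≤x⊔y x′ y′))

  ⊓-comm-≤ : ∀ x y → x ⊓ y ≤ y ⊓ x
  ⊓-comm-≤ x y = ⊓-greatest (x⊓y≤y x y) (x⊓y≤x x y)

  ⊓-assoc-≤ : ∀ x y z → (x ⊓ y) ⊓ z ≤ x ⊓ (y ⊓ z)
  ⊓-assoc-≤ x y z =
    ⊓-greatest (≤-trans (x⊓y≤x (x ⊓ y) z) (x⊓y≤x x y)) (⊓-mono (x⊓y≤y x y) ≤-refl)

  x≤x⊓x : ∀ x → x ≤ x ⊓ x
  x≤x⊓x x = ⊓-greatest ≤-refl ≤-refl

  ⊓-distribˡ-⊔ : ∀ x y z → x ⊓ (y ⊔ z) ≤ x ⊓ y ⊔ x ⊓ z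
  ⊓-distribˡ-⊔ x y z =
    ≤-trans (⊓-comm-≤ x (y ⊔ z))
            (≤-trans (⊓-distribʳ-⊔ x y z) (⊔-mono (⊓-comm-≤ y x) (⊓-comm-≤ z x)))

  ∙-monoˡ : ∀ {x x′ y} → x ≤ x′ → x ∙ y ≤ x′ ∙ y
  ∙-monoˡ x≤x′ = transpose-∙ (≤-trans x≤x′ (transpose-⇒ ≤-refl))

  ∙-mono : ∀ {x x′ y y′} → x ≤ x′ → y ≤ y′ → x ∙ y ≤ x′ ∙ y′
  ∙-mono x≤x′ y≤y′ = ≤-trans (∙-monoˡ x≤x′) (∙-monoʳ y≤y′)

  ∙-distribʳ-⊔ : ∀ x y z → (y ⊔ z) ∙ x ≤ y ∙ x ⊔ z ∙ x
  ∙-distribʳ-⊔ x y z =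
    transpose-∙ (⊔-least (transpose-⇒ (x≤x⊔y (y ∙ x) (z ∙ x)))
                         (transpose-⇒ (y≤x⊔y (y ∙ x) (z ∙ x))))

module _ (𝔸 : BAlgebra) where
  open BAlgebra 𝔸

  record FixedPoint (c : Carrier) : Set where
    field
      ⊓-fixed : c ⊓ c ≡ c
      ⊔-fixed : c ⊔ c ≡ c
      ∙-fixed : c ∙ c ≡ c
      ⇒-fixed : c ⇒ c ≡ c
      ∼-fixed : ∼ c ≡ c

d+1-1≡d : ∀ d → d + 1ℤ - 1ℤ ≡ d
d+1-1≡d = //-rightDividesʳ 1ℤ

d-1+1≡d : ∀ d → d - 1ℤ + 1ℤ ≡ d
d-1+1≡d = //-rightDividesˡ 1ℤ

module Interpretation (𝔸 : BAlgebra) (v : ℕ → ℤ → BAlgebra.Carrier 𝔸) where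
  open BAlgebra 𝔸
  open BAlgebraProperties 𝔸

  ⟦_⟧ : Formula → ℤ → Carrier
  ⟦ atom p ⟧  d = v p d
  ⟦ ¬'_ A ⟧   d = ∼ ⟦ A ⟧ d
  ⟦ A ∧' B ⟧  d = ⟦ A ⟧ d ⊓ ⟦ B ⟧ d
  ⟦ A ∨' B ⟧  d = ⟦ A ⟧ d ⊔ ⟦ B ⟧ d
  ⟦ A ⇒' B ⟧  d = ⟦ A ⟧ (d + 1ℤ) ⇒ ⟦ B ⟧ (d + 1ℤ)
  ⟦ A ∘' B ⟧  d = ⟦ A ⟧ (d - 1ℤ) ∙ ⟦ B ⟧ d

  ⟦_⟧ᴮ : Bunch → ℤ → Carrier
  ⟦ fm A ⟧ᴮ   d = ⟦ A ⟧ d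
  ⟦ X ,, Y ⟧ᴮ d = ⟦ X ⟧ᴮ d ⊓ ⟦ Y ⟧ᴮ d
  ⟦ X ︔ Y ⟧ᴮ  d = ⟦ X ⟧ᴮ (d - 1ℤ) ∙ ⟦ Y ⟧ᴮ d

  infix 4 _≼_ _⊨_

  _≼_ : Bunch → Bunch → Set
  X ≼ Y = ∀ d → ⟦ X ⟧ᴮ d ≤ ⟦ Y ⟧ᴮ d

  _⊨_ : Bunch → Formula → Set
  X ⊨ A = X ≼ fm A

  []-mono : ∀ W {Y Z} → Y ≼ Z → W [ Y ] ≼ W [ Z ]
  []-mono hole      Y≼Z   = Y≼Z
  []-mono (W ,,ˡ U) Y≼Z d = ⊓-mono ([]-mono W Y≼Z d) ≤-refl
  []-mono (U ,,ʳ W) Y≼Z d = ⊓-mono ≤-refl ([]-mono W Y≼Z d)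
  []-mono (W ︔ˡ U)  Y≼Z d = ∙-monoˡ ([]-mono W Y≼Z (d - 1ℤ))
  []-mono (U ︔ʳ W)  Y≼Z d = ∙-monoʳ ([]-mono W Y≼Z d)

  []-distrib-∨ : ∀ W {A B} d →
                 ⟦ W [ fm (A ∨' B) ] ⟧ᴮ d ≤ ⟦ W [ fm A ] ⟧ᴮ d ⊔ ⟦ W [ fm B ] ⟧ᴮ d
  []-distrib-∨ hole      d = ≤-refl
  []-distrib-∨ (W ,,ˡ U) d = ≤-trans (⊓-mono ([]-distrib-∨ W d) ≤-refl) (⊓-distribʳ-⊔ _ _ _)
  []-distrib-∨ (U ,,ʳ W) d = ≤-trans (⊓-mono ≤-refl ([]-distrib-∨ W d)) (⊓-distribˡ-⊔ _ _ _)
  []-distrib-∨ (W ︔ˡ U)  d = ≤-trans (∙-monoˡ ([]-distrib-∨ W (d - 1ℤ))) (∙-distribʳ-⊔ _ _ _)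
  []-distrib-∨ (U ︔ʳ W)  d = ≤-trans (∙-monoʳ ([]-distrib-∨ W d)) (∙-distribˡ-⊔ _ _ _)

  soundness : ∀ {X A} → X ⊢ A → X ⊨ A
  soundness id             d = ≤-refl
  soundness (→I {X} {A} {B} p) d =
    transpose-⇒ (subst (λ e → ⟦ X ⟧ᴮ e ∙ ⟦ A ⟧ (d + 1ℤ) ≤ ⟦ B ⟧ (d + 1ℤ))
                       (d+1-1≡d d) (soundness p (d + 1ℤ)))
  soundness (→E {X} {A = A} {B = B} p q) d =
    ≤-trans (∙-monoʳ (soundness q d))
            (transpose-∙ (subst (λ e → ⟦ X ⟧ᴮ (d - 1ℤ) ≤ ⟦ A ⟧ e ⇒ ⟦ B ⟧ e)
                                (d-1+1≡d d) (soundness p (d - 1ℤ))))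
  soundness (∨I₁ p)      d = ≤-trans (soundness p d) (x≤x⊔y _ _)
  soundness (∨I₂ p)      d = ≤-trans (soundness p d) (y≤x⊔y _ _)
  soundness (∨E W p q r) d = ≤-trans ([]-mono W (soundness p) d)
    (≤-trans ([]-distrib-∨ W d) (⊔-least (soundness q d) (soundness r d)))
  soundness (∧I p q)     d = ⊓-mono (soundness p d) (soundness q d)
  soundness (∧E W p q)   d = ≤-trans ([]-mono W (soundness p) d) (soundness q d)
  soundness (∘I p q)     d = ∙-mono (soundness p (d - 1ℤ)) (soundness q d)
  soundness (∘E W p q)   d = ≤-trans ([]-mono W (soundness p) d) (soundness q d)
  soundness (¬I p q)     d = ≤-trans (soundness p d) (∼-contrapose (soundness q d))
  soundness (¬E p)       d = ≤-trans (soundness p d) (∼∼x≤x _)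
  soundness (cut W p q)  d = ≤-trans ([]-mono W (soundness p) d) (soundness q d)
  soundness (assoc W p)  d = ≤-trans ([]-mono W (λ _ → ⊓-assoc-≤ _ _ _) d) (soundness p d)
  soundness (comm W p)   d = ≤-trans ([]-mono W (λ _ → ⊓-comm-≤ _ _) d) (soundness p d)
  soundness (contr W p)  d = ≤-trans ([]-mono W (λ _ → x≤x⊓x _) d) (soundness p d)
  soundness (weak W p)   d = ≤-trans ([]-mono W (λ _ → x⊓y≤x _ _) d) (soundness p d)

  module _ {c : Carrier} (fixed : FixedPoint 𝔸 c) where
    open FixedPoint fixed

    private
      fixed₂ : ∀ (_·_ : Carrier → Carrier → Carrier) {x y} →
               c · c ≡ c → x ≡ c → y ≡ c → x · y ≡ c
      fixed₂ _ c·c≡c refl refl = c·c≡c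

    ⟦⟧-constant : ∀ d A → (∀ {p k} → OccF d p k A → v p k ≡ c) → ⟦ A ⟧ d ≡ c
    ⟦⟧-constant d (atom p) v≡c = v≡c here
    ⟦⟧-constant d (¬'_ A)  v≡c = trans (cong ∼_ (⟦⟧-constant d A (v≡c ∘ OccF.¬'))) ∼-fixed
    ⟦⟧-constant d (A ∧' B) v≡c =
      fixed₂ _⊓_ ⊓-fixed (⟦⟧-constant d A (v≡c ∘ ∧ˡ)) (⟦⟧-constant d B (v≡c ∘ ∧ʳ))
    ⟦⟧-constant d (A ∨' B) v≡c =
      fixed₂ _⊔_ ⊔-fixed (⟦⟧-constant d A (v≡c ∘ ∨ˡ)) (⟦⟧-constant d B (v≡c ∘ ∨ʳ))
    ⟦⟧-constant d (A ⇒' B) v≡c =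
      fixed₂ _⇒_ ⇒-fixed (⟦⟧-constant (d + 1ℤ) A (v≡c ∘ ⇒ˡ))
                         (⟦⟧-constant (d + 1ℤ) B (v≡c ∘ ⇒ʳ))
    ⟦⟧-constant d (A ∘' B) v≡c =
      fixed₂ _∙_ ∙-fixed (⟦⟧-constant (d - 1ℤ) A (v≡c ∘ ∘ˡ)) (⟦⟧-constant d B (v≡c ∘ ∘ʳ))

    ⟦⟧ᴮ-constant : ∀ d X → (∀ {p k} → OccB d p k X → v p k ≡ c) → ⟦ X ⟧ᴮ d ≡ c
    ⟦⟧ᴮ-constant d (fm A)   v≡c = ⟦⟧-constant d A (v≡c ∘ fm)
    ⟦⟧ᴮ-constant d (X ,, Y) v≡c =
      fixed₂ _⊓_ ⊓-fixed (⟦⟧ᴮ-constant d X (v≡c ∘ ,ˡ)) (⟦⟧ᴮ-constant d Y (v≡c ∘ ,ʳ))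
    ⟦⟧ᴮ-constant d (X ︔ Y)  v≡c =
      fixed₂ _∙_ ∙-fixed (⟦⟧ᴮ-constant (d - 1ℤ) X (v≡c ∘ OccB.︔ˡ))
                         (⟦⟧ᴮ-constant d Y (v≡c ∘ OccB.︔ʳ))

Meet : REL ℕ ℤ 0ℓ → REL ℕ ℤ 0ℓ → Set
Meet P Q = Σ ℕ λ p → Σ ℤ λ k → P p k × Q p k

module _ {P : REL ℕ ℤ 0ℓ} where

  Meet-map : ∀ {Q Q′} → Q ⊆ Q′ → Meet P Q → Meet P Q′
  Meet-map Q⊆Q′ (p , k , x , q) = p , k , x , Q⊆Q′ q

  meet-map? : ∀ {Q Q′} → Q ⊆ Q′ → Q′ ⊆ Q → Dec (Meet P Q) → Dec (Meet P Q′)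
  meet-map? Q⊆Q′ Q′⊆Q = map′ (Meet-map Q⊆Q′) (Meet-map Q′⊆Q)

  meet-⊎? : ∀ {Q Q₁ Q₂} → Q₁ ⊆ Q → Q₂ ⊆ Q → Q ⊆ (λ p k → Q₁ p k ⊎ Q₂ p k) →
            Dec (Meet P Q₁) → Dec (Meet P Q₂) → Dec (Meet P Q)
  meet-⊎? {Q} {Q₁} {Q₂} Q₁⊆Q Q₂⊆Q split Q₁? Q₂? =
    map′ [ Meet-map Q₁⊆Q , Meet-map Q₂⊆Q ]′ unsplit (Q₁? ⊎-dec Q₂?)
    where
    unsplit : Meet P Q → Meet P Q₁ ⊎ Meet P Q₂
    unsplit (p , k , x , q) = Sum.map (λ q₁ → p , k , x , q₁) (λ q₂ → p , k , x , q₂) (split q)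

module _ {P : REL ℕ ℤ 0ℓ} (P? : ∀ p k → Dec (P p k)) where

  meet-OccF? : ∀ d A → Dec (Meet P (λ p k → OccF d p k A))
  meet-OccF? d (atom q) = map′ (λ x → q , d , x , here) (λ { (_ , _ , x , here) → x }) (P? q d)
  meet-OccF? d (¬'_ A)  = meet-map? OccF.¬' (λ { (OccF.¬' o) → o }) (meet-OccF? d A)
  meet-OccF? d (A ∧' B) = meet-⊎? ∧ˡ ∧ʳ (λ { (∧ˡ o) → inj₁ o ; (∧ʳ o) → inj₂ o })
    (meet-OccF? d A) (meet-OccF? d B)
  meet-OccF? d (A ∨' B) = meet-⊎? ∨ˡ ∨ʳ (λ { (∨ˡ o) → inj₁ o ; (∨ʳ o) → inj₂ o })
    (meet-OccF? d A) (meet-OccF? d B)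
  meet-OccF? d (A ⇒' B) = meet-⊎? ⇒ˡ ⇒ʳ (λ { (⇒ˡ o) → inj₁ o ; (⇒ʳ o) → inj₂ o })
    (meet-OccF? (d + 1ℤ) A) (meet-OccF? (d + 1ℤ) B)
  meet-OccF? d (A ∘' B) = meet-⊎? ∘ˡ ∘ʳ (λ { (∘ˡ o) → inj₁ o ; (∘ʳ o) → inj₂ o })
    (meet-OccF? (d - 1ℤ) A) (meet-OccF? d B)

  meet-OccB? : ∀ d X → Dec (Meet P (λ p k → OccB d p k X))
  meet-OccB? d (fm A)   = meet-map? fm (λ { (fm o) → o }) (meet-OccF? d A)
  meet-OccB? d (X ,, Y) = meet-⊎? ,ˡ ,ʳ (λ { (,ˡ o) → inj₁ o ; (,ʳ o) → inj₂ o })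
    (meet-OccB? d X) (meet-OccB? d Y)
  meet-OccB? d (X ︔ Y)  = meet-⊎? OccB.︔ˡ OccB.︔ʳ
    (λ { (OccB.︔ˡ o) → inj₁ o ; (OccB.︔ʳ o) → inj₂ o })
    (meet-OccB? (d - 1ℤ) X) (meet-OccB? d Y)

occB? : ∀ d p k X → Dec (OccB d p k X)
occB? d p k X =
  map′ (λ { (_ , _ , (refl , refl) , o) → o }) (λ o → p , k , (refl , refl) , o)
       (meet-OccB? (λ p′ k′ → p′ ℕ.≟ p ×-dec k′ ℤ.≟ k) d X)

depthShare? : ∀ X A → Dec (DepthShare X A)
depthShare? X A = meet-OccF? (λ p k → occB? 0ℤ p k X) 0ℤ A

data Four : Set where
  f n b t : Four

all? : {P : Four → Set} → (∀ x → Dec (P x)) → Dec (∀ x → P x)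
all? P? = map′ (λ { (pf , pn , pb , pt) → λ { f → pf ; n → pn ; b → pb ; t → pt } })
             (λ h → h f , h n , h b , h t)
             (P? f ×-dec P? n ×-dec P? b ×-dec P? t)

FOUR : BAlgebra
FOUR = record
  { Carrier      = Four
  ; _≤_          = _≤_
  ; _⊓_          = _⊓_
  ; _⊔_          = _⊔_
  ; _∙_          = _∙_
  ; _⇒_          = _⇒_
  ; ∼_           = ∼_
  ; ≤-refl       = λ {x} → from-yes (all? λ x → x ≤? x) x
  ; ≤-trans      = λ {x y z} → from-yes (all? λ x → all? λ y → all? λ z →
                     x ≤? y →-dec y ≤? z →-dec x ≤? z) x y z
  ; x⊓y≤x        = from-yes (all? λ x → all? λ y → x ⊓ y ≤? x)
  ; x⊓y≤y        = from-yes (all? λ x → all? λ y → x ⊓ y ≤? y)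
  ; ⊓-greatest   = λ {x y z} → from-yes (all? λ x → all? λ y → all? λ z →
                     x ≤? y →-dec x ≤? z →-dec x ≤? y ⊓ z) x y z
  ; x≤x⊔y        = from-yes (all? λ x → all? λ y → x ≤? x ⊔ y)
  ; y≤x⊔y        = from-yes (all? λ x → all? λ y → y ≤? x ⊔ y)
  ; ⊔-least      = λ {x y z} → from-yes (all? λ x → all? λ y → all? λ z →
                     x ≤? z →-dec y ≤? z →-dec x ⊔ y ≤? z) x y z
  ; ⊓-distribʳ-⊔ = from-yes (all? λ x → all? λ y → all? λ z → (y ⊔ z) ⊓ x ≤? y ⊓ x ⊔ z ⊓ x)
  ; ∙-monoʳ      = λ {x y y′} → from-yes (all? λ x → all? λ y → all? λ y′ →
                     y ≤? y′ →-dec x ∙ y ≤? x ∙ y′) x y y′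
  ; ∙-distribˡ-⊔ = from-yes (all? λ x → all? λ y → all? λ z → x ∙ (y ⊔ z) ≤? x ∙ y ⊔ x ∙ z)
  ; transpose-⇒  = λ {x y z} → from-yes (all? λ x → all? λ y → all? λ z →
                     x ∙ y ≤? z →-dec x ≤? y ⇒ z) x y z
  ; transpose-∙  = λ {x y z} → from-yes (all? λ x → all? λ y → all? λ z →
                     x ≤? y ⇒ z →-dec x ∙ y ≤? z) x y z
  ; ∼-contrapose = λ {x y} → from-yes (all? λ x → all? λ y → x ≤? ∼ y →-dec y ≤? ∼ x) x y
  ; ∼∼x≤x        = from-yes (all? λ x → ∼ ∼ x ≤? x)
  }
  where
  infix  4 _≤ᵇ_ _≤_ _≤?_
  infixr 5 _⇒_
  infixr 6 _⊔_
  infixr 7 _⊓_ _∙_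
  infix  8 ∼_

  _≤ᵇ_ : Four → Four → Bool
  f ≤ᵇ _ = true
  _ ≤ᵇ t = true
  n ≤ᵇ n = true
  b ≤ᵇ b = true
  _ ≤ᵇ _ = false

  _≤_ : Four → Four → Set
  x ≤ y = T (x ≤ᵇ y)

  _≤?_ : ∀ x y → Dec (x ≤ y)
  x ≤? y = T? (x ≤ᵇ y)

  _⊓_ _⊔_ _∙_ _⇒_ : Four → Four → Four
  f ⊓ _ = f
  t ⊓ y = y
  _ ⊓ f = f
  x ⊓ t = x
  n ⊓ n = n
  b ⊓ b = b
  _ ⊓ _ = f

  f ⊔ y = y
  t ⊔ _ = t
  x ⊔ f = x
  _ ⊔ t = t
  n ⊔ n = n
  b ⊔ b = b
  _ ⊔ _ = t

  _ ∙ f = f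
  x ∙ _ = x

  f ⇒ _ = t
  _ ⇒ y = y

  ∼_ : Four → Four
  ∼ f = t
  ∼ n = n
  ∼ b = b
  ∼ t = f

b-fixed : FixedPoint FOUR b
b-fixed = record
  { ⊓-fixed = refl ; ⊔-fixed = refl ; ∙-fixed = refl ; ⇒-fixed = refl ; ∼-fixed = refl }

n-fixed : FixedPoint FOUR n
n-fixed = record
  { ⊓-fixed = refl ; ⊔-fixed = refl ; ∙-fixed = refl ; ⇒-fixed = refl ; ∼-fixed = refl }

open BAlgebra FOUR using (_≤_)

b≰n : ¬ b ≤ n
b≰n ()

module Separation (X : Bunch) where

  colour : Bool → Four
  colour true  = b
  colour false = n

  separating : ℕ → ℤ → Four
  separating p k = colour (does (occB? 0ℤ p k X))

  open Interpretation FOUR separating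

  ⟦X⟧≡b : ⟦ X ⟧ᴮ 0ℤ ≡ b
  ⟦X⟧≡b = ⟦⟧ᴮ-constant b-fixed 0ℤ X
    (λ {p} {k} o → cong colour (dec-true (occB? 0ℤ p k X) o))

  ⟦A⟧≡n : ∀ A → ¬ DepthShare X A → ⟦ A ⟧ 0ℤ ≡ n
  ⟦A⟧≡n A ¬share = ⟦⟧-constant n-fixed 0ℤ A
    (λ {p} {k} o → cong colour (dec-false (occB? 0ℤ p k X) (λ x → ¬share (p , k , x , o))))

  ¬¬depthShare : ∀ {A} → X ⊢ A → ¬ ¬ DepthShare X A
  ¬¬depthShare {A} ⊢A ¬share =
    b≰n (subst₂ _≤_ ⟦X⟧≡b (⟦A⟧≡n A ¬share) (soundness ⊢A 0ℤ))

corollary23 : ∀ (X : Bunch) (A : Formula) → X ⊢ A → DepthShare X A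
corollary23 X A ⊢A = decidable-stable (depthShare? X A) (Separation.¬¬depthShare X ⊢A)
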